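{- Let $S$ be a string of length $n$ and let $0\le i\le j<n$. Then $B[i][j]=1$ if and only if $H[f(i,j)][j]\ge i$.
   Context: For $l\le r$, $f(l,r)$ is the maximum number of occurrences of a single character in $S[l],\dots,S[r]$. A mode of $S[l..r]$ is a character attaining this maximum. $m=f(0,n-1)$. For $0\le i,j<n$, $B[i][j]=1$ if and only if $i\le j$ and $S[j]$ is a mode of $S[i..j]$; otherwise $B[i][j]=0$. For $1\le g\le m$ and $0\le j<n$, $H[g][j]=\max\left(\{k: f(k,j)=g \text{ and } B[k][j]=1\}\cup\{ -1\}\right)$. -}

module Defs where

open import Data.Nat as ℕ using (ℕ; _≤_; _≤?_; _⊔_)
open import Data.Integer as ℤ using (ℤ; +_; -[1+_])
open import Data.Fin using (Fin; toℕ)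
open import Data.List using (List; map; foldr; allFin)
open import Data.Nat.ListAction using (sum)
open import Data.Bool using (Bool; if_then_else_; _∧_)
open import Data.Product using (_×_)
open import Relation.Binary.PropositionalEquality using (_≡_)
open import Relation.Binary.Definitions using (DecidableEquality)
open import Relation.Nullary using (Dec)
open import Relation.Nullary.Decidable using (⌊_⌋; _×-dec_)

module StringDefs {a} {A : Set a} (_≟_ : DecidableEquality A)
                  (n : ℕ) (S : Fin n → A) where

  inRange : Fin n → Fin n → Fin n → Bool
  inRange l r k = ⌊ toℕ l ≤? toℕ k ⌋ ∧ ⌊ toℕ k ≤? toℕ r ⌋

  count : A → Fin n → Fin n → ℕ
  count c l r =
    sum (map (λ k → if inRange l r k ∧ ⌊ S k ≟ c ⌋ then 1 else 0) (allFin n))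

  -- f(l,r): maximum number of occurrences of a single character in S[l..r]
  -- (characters not occurring in S[l..r] have count 0, so it suffices to
  --  maximise over the characters S[k], l ≤ k ≤ r)
  f : Fin n → Fin n → ℕ
  f l r = foldr _⊔_ 0
    (map (λ k → if inRange l r k then count (S k) l r else 0) (allFin n))

  IsMode : A → Fin n → Fin n → Set
  IsMode c l r = count c l r ≡ f l r

  B : Fin n → Fin n → Set
  B i j = (toℕ i ≤ toℕ j) × IsMode (S j) i j

  B? : (i j : Fin n) → Dec (B i j)
  B? i j = (toℕ i ≤? toℕ j) ×-dec (count (S j) i j ℕ.≟ f i j)

  H : ℕ → Fin n → ℤ
  H g j = foldr ℤ._⊔_ -[1+ 0 ]
    (map (λ k → if ⌊ f k j ℕ.≟ g ⌋ ∧ ⌊ B? k j ⌋ then + toℕ k else -[1+ 0 ])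
         (allFin n))

-- Every k with f(k,j) = f(i,j) that is counted in H[f(i,j)][j] has S[j] as a mode of the
-- suffix window S[k..j]; if moreover k ≥ i, then S[j] occurs in S[i..j] at least as often
-- as in S[k..j], i.e. at least f(i,j) times, so S[j] is a mode of S[i..j] as well.
module Submission where

open import Defs
open import Data.Nat using (ℕ; _≤_; _≤?_; z≤n)
open import Data.Integer as ℤ using (+_)
open import Data.Fin using (Fin; toℕ)
open import Function.Bundles using (_⇔_; mk⇔; module Equivalence)
open import Relation.Binary.Definitions using (DecidableEquality)

open import Algebra.Construct.NaturalChoice.Base using (MaxOperator)
import Algebra.Construct.NaturalChoice.MaxOp as MaxOp
open import Data.Bool using (true; false; T; if_then_else_; _∧_)
open import Data.Bool.Properties using (T-≡; if-cong)
import Data.Integer.Properties as ℤ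
open import Data.List using (List; []; _∷_; map; foldr; allFin)
open import Data.List.Membership.Propositional using (lose)
open import Data.List.Membership.Propositional.Properties using (∈-allFin)
open import Data.List.Properties using (foldr-preservesᵒ)
open import Data.List.Relation.Unary.Any using (Any; here; there; satisfied)
open import Data.List.Relation.Unary.Any.Properties using (map⁺; map⁻)
open import Data.Nat.ListAction using (sum)
import Data.Nat.Properties as ℕ
open import Data.Product using (_×_; _,_; ∃)
open import Data.Sum as Sum using (_⊎_; inj₁; inj₂; [_,_])
open import Data.Empty using (⊥-elim)
open import Relation.Binary.Bundles using (TotalPreorder)
open import Relation.Binary.PropositionalEquality using (_≡_; refl; sym; trans; subst)
open import Relation.Nullary using (Dec; yes; no)
open import Relation.Nullary.Decidable using (⌊_⌋)

open Equivalence using (to; from)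

module FoldrMax {a ℓ₁ ℓ₂} {O : TotalPreorder a ℓ₁ ℓ₂} (maxOp : MaxOperator O) where
  open TotalPreorder O using (_≲_; ≲-respʳ-≈)
  open MaxOperator maxOp using (_⊔_)
  open MaxOp maxOp using (⊔-sel; x≤y⇒x≤y⊔z; x≤y⇒x≤z⊔y)

  ≤-foldr-⊔⁺ : ∀ {v} e xs → v ≲ e ⊎ Any (v ≲_) xs → v ≲ foldr _⊔_ e xs
  ≤-foldr-⊔⁺ = foldr-preservesᵒ (λ x y → [ x≤y⇒x≤y⊔z y , x≤y⇒x≤z⊔y x ])

  ≤-foldr-⊔⁻ : ∀ {v} e xs → v ≲ foldr _⊔_ e xs → v ≲ e ⊎ Any (v ≲_) xs
  ≤-foldr-⊔⁻ e []       v≤e = inj₁ v≤e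
  ≤-foldr-⊔⁻ e (x ∷ xs) v≤  with ⊔-sel x (foldr _⊔_ e xs)
  ... | inj₁ ⊔≈x = inj₂ (here (≲-respʳ-≈ ⊔≈x v≤))
  ... | inj₂ ⊔≈r = Sum.map₂ there (≤-foldr-⊔⁻ e xs (≲-respʳ-≈ ⊔≈r v≤))

module ℕMax = FoldrMax ℕ.⊔-operator
module ℤMax = FoldrMax ℤ.⊔-operator

sum-map-mono : ∀ {b} {B : Set b} {g h : B → ℕ} (xs : List B) →
               (∀ x → g x ≤ h x) → sum (map g xs) ≤ sum (map h xs)
sum-map-mono []       g≤h = z≤n
sum-map-mono (x ∷ xs) g≤h = ℕ.+-mono-≤ (g≤h x) (sum-map-mono xs g≤h)

indicator-∧-mono : ∀ {b₁ b₂} e → (T b₁ → T b₂) →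
                   (if b₁ ∧ e then 1 else 0) ≤ (if b₂ ∧ e then 1 else 0)
indicator-∧-mono {false}         e b₁⇒b₂ = z≤n
indicator-∧-mono {true} {true}   e b₁⇒b₂ = ℕ.≤-refl
indicator-∧-mono {true} {false}  e b₁⇒b₂ = ⊥-elim (b₁⇒b₂ _)

T-⌊⌋∧⌊⌋ : ∀ {p q} {P : Set p} {Q : Set q} (p? : Dec P) (q? : Dec Q) → T (⌊ p? ⌋ ∧ ⌊ q? ⌋) ⇔ (P × Q)
T-⌊⌋∧⌊⌋ (yes p) (yes q) = mk⇔ (λ _ → p , q) _
T-⌊⌋∧⌊⌋ (yes _) (no ¬q) = mk⇔ (λ ()) (λ (_ , q) → ¬q q)
T-⌊⌋∧⌊⌋ (no ¬p) _       = mk⇔ (λ ()) (λ (p , _) → ¬p p)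

module _ {a} {A : Set a} (_≟_ : DecidableEquality A) (n : ℕ) (S : Fin n → A) where
  open StringDefs _≟_ n S

  inRange⁺ : ∀ {l r k} → toℕ l ≤ toℕ k → toℕ k ≤ toℕ r → T (inRange l r k)
  inRange⁺ {l} {r} {k} l≤k k≤r = from (T-⌊⌋∧⌊⌋ (toℕ l ≤? toℕ k) (toℕ k ≤? toℕ r)) (l≤k , k≤r)

  inRange⁻ : ∀ {l r k} → T (inRange l r k) → toℕ l ≤ toℕ k × toℕ k ≤ toℕ r
  inRange⁻ {l} {r} {k} = to (T-⌊⌋∧⌊⌋ (toℕ l ≤? toℕ k) (toℕ k ≤? toℕ r))

  count-antitoneˡ : ∀ c {i k j} → toℕ i ≤ toℕ k → count c k j ≤ count c i j
  count-antitoneˡ c {i} {k} {j} i≤k =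
    sum-map-mono (allFin n) (λ x → indicator-∧-mono ⌊ S x ≟ c ⌋ widen)
    where
    widen : ∀ {x} → T (inRange k j x) → T (inRange i j x)
    widen kjx with k≤x , x≤j ← inRange⁻ kjx = inRange⁺ (ℕ.≤-trans i≤k k≤x) x≤j

  count≤f : ∀ {i k j} → toℕ i ≤ toℕ k → toℕ k ≤ toℕ j → count (S k) i j ≤ f i j
  count≤f {i} {k} {j} i≤k k≤j =
    ℕMax.≤-foldr-⊔⁺ 0 _ (inj₂ (map⁺ (lose (∈-allFin k) count≤entry)))
    where
    count≤entry : count (S k) i j ≤ (if inRange i j k then count (S k) i j else 0)
    count≤entry = ℕ.≤-reflexive (sym (if-cong (to T-≡ (inRange⁺ i≤k k≤j))))

  mode-widenˡ : ∀ {i k j} → toℕ i ≤ toℕ k → toℕ k ≤ toℕ j → f k j ≡ f i j →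
                IsMode (S j) k j → IsMode (S j) i j
  mode-widenˡ {i} {k} {j} i≤k k≤j fk≡fi mode = ℕ.≤-antisym
    (count≤f (ℕ.≤-trans i≤k k≤j) ℕ.≤-refl)
    (subst (_≤ count (S j) i j) (trans mode fk≡fi) (count-antitoneˡ (S j) i≤k))

  H-candidate : ℕ → Fin n → Fin n → ℤ.ℤ
  H-candidate g j k = if ⌊ f k j ℕ.≟ g ⌋ ∧ ⌊ B? k j ⌋ then + toℕ k else ℤ.-[1+ 0 ]

  candidate-accepted : ∀ {g j k} → f k j ≡ g → B k j → H-candidate g j k ≡ + toℕ k
  candidate-accepted {g} {j} {k} fk≡g Bkj =
    if-cong (to T-≡ (from (T-⌊⌋∧⌊⌋ (f k j ℕ.≟ g) (B? k j)) (fk≡g , Bkj)))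

  ≤candidate⇒accepted : ∀ {g} {i j k : Fin n} → + toℕ i ℤ.≤ H-candidate g j k →
                        f k j ≡ g × B k j × toℕ i ≤ toℕ k
  ≤candidate⇒accepted {g} {i} {j} {k} i≤c with f k j ℕ.≟ g | B? k j
  ... | yes fk≡g | yes Bkj = fk≡g , Bkj , ℤ.drop‿+≤+ i≤c
  ... | yes _    | no _    with () ← i≤c
  ... | no _     | _       with () ← i≤c

  ≤H⁺ : ∀ {g} {i j : Fin n} k → f k j ≡ g → B k j → toℕ i ≤ toℕ k → + toℕ i ℤ.≤ H g j
  ≤H⁺ {g} {i} {j} k fk≡g Bkj i≤k = ℤMax.≤-foldr-⊔⁺ _ (map (H-candidate g j) (allFin n))
    (inj₂ (map⁺ (lose (∈-allFin k) i≤candidate)))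
    where
    i≤candidate : + toℕ i ℤ.≤ H-candidate g j k
    i≤candidate = subst (_ ℤ.≤_) (sym (candidate-accepted fk≡g Bkj)) (ℤ.+≤+ i≤k)

  ≤H⁻ : ∀ {g} {i j : Fin n} → + toℕ i ℤ.≤ H g j → ∃ λ k → f k j ≡ g × B k j × toℕ i ≤ toℕ k
  ≤H⁻ {g} {i} {j} i≤H with ℤMax.≤-foldr-⊔⁻ _ (map (H-candidate g j) (allFin n)) i≤H
  ... | inj₁ ()
  ... | inj₂ i≤some-candidate with k , i≤c ← satisfied (map⁻ i≤some-candidate) =
    k , ≤candidate⇒accepted i≤c

lemma8 : ∀ {a} {A : Set a} (_≟_ : DecidableEquality A) (n : ℕ) (S : Fin n → A)
         (i j : Fin n) → toℕ i ≤ toℕ j →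
         StringDefs.B _≟_ n S i j ⇔ (+ toℕ i ℤ.≤ StringDefs.H _≟_ n S (StringDefs.f _≟_ n S i j) j)
lemma8 _≟_ n S i j i≤j = mk⇔ (λ Bij → ≤H⁺ _≟_ n S i refl Bij ℕ.≤-refl) λ i≤H →
  let open StringDefs _≟_ n S
      k , fk≡fi , (k≤j , mode) , i≤k = ≤H⁻ _≟_ n S i≤H
  in  i≤j , mode-widenˡ _≟_ n S i≤k k≤j fk≡fi mode
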